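{- Let $b\ge2$ and $k\ge0$ be integers. Then $$\alpha_k(\mathbb{Z},b)=\sum_{i=1}^\infty\left\lfloor\frac{k}{b^i}\right\rfloor.$$ Moreover, for $k=0,1,2,\dots$, $$k!_{\mathbb{Z},\mathbb{N}}=\prod_{b=2}^k b^{\alpha_k(\mathbb{Z},b)}.$$
   Context: For integers $b\ge0$ and $a\in\mathbb{Z}$ let $\operatorname{ord}_b(a):=\sup\{k\in\mathbb{N}: a\mathbb{Z}\subseteq b^k\mathbb{Z}\}$ (convention $0^0=1$); for $b\ge2$ this is the largest $k$ with $b^k\mid a$, $\operatorname{ord}_b(0)=+\infty$; $\operatorname{ord}_1\equiv+\infty$; $\operatorname{ord}_0(a)=0$ for $a\ne0$, $\operatorname{ord}_0(0)=+\infty$. For nonempty $S\subseteq\mathbb{Z}$, a $b$-ordering of $S$ is an infinite sequence $(a_i)_{i\ge0}$ in $S$ such that for every $i\ge1$, $\sum_{j<i}\operatorname{ord}_b(a_i-a_j)=\min_{a'\in S}\sum_{j<i}\operatorname{ord}_b(a'-a_j)$. The quantity $\alpha_k(S,b):=\sum_{j<k}\operatorname{ord}_b(a_k-a_j)$ (with $\alpha_0=0$) does not depend on the choice of $b$-ordering. For $\mathcal{T}\subseteq\mathbb{N}$, $k!_{S,\mathcal{T}}:=\prod_{b\in\mathcal{T}}b^{\alpha_k(S,b)}$, with conventions $b^{+\infty}=0$ for $b\ge2$ and $b=0$, $1^{+\infty}=1$, and $b^0=1$ for all $b$. -}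

module Defs where

open import Data.Nat using (ℕ; zero; suc; _+_; _*_; _^_; _≤_; _/_)
import Data.Nat as ℕ
open import Data.Nat.Divisibility using (_∣?_)
open import Data.Integer using (ℤ; ∣_∣; _-_)
open import Data.Unit using (⊤)
open import Data.Empty using (⊥)
open import Data.Product using (Σ; _×_)
open import Relation.Nullary using (yes; no)
open import Relation.Binary.PropositionalEquality using (_≡_)

data ℕ∞ : Set where
  fin : ℕ → ℕ∞
  ∞   : ℕ∞

infixl 6 _+∞_
_+∞_ : ℕ∞ → ℕ∞ → ℕ∞
fin m +∞ fin n = fin (m + n)
fin _ +∞ ∞     = ∞
∞     +∞ _     = ∞

infix 4 _≤∞_
data _≤∞_ : ℕ∞ → ℕ∞ → Set where
  fin≤fin : ∀ {m n} → m ≤ n → fin m ≤∞ fin n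
  _≤∞∞    : ∀ x → x ≤∞ ∞

largestPow : (d n bound : ℕ) → ℕ
largestPow d n zero = zero
largestPow d n (suc k) with (d ^ suc k) ∣? n
... | yes _ = suc k
... | no  _ = largestPow d n k

-- ord_b(a) = sup { k : aℤ ⊆ b^k ℤ }  (value in ℕ ∪ {+∞})
--   b ≥ 2 : largest k with b^k ∣ a (such k satisfy k ≤ |a| when a ≠ 0), ord_b(0) = +∞
--   b = 1 : +∞ ;  b = 0 : 0 for a ≠ 0, +∞ for a = 0
ord : ℕ → ℤ → ℕ∞
ord zero a with ∣ a ∣
... | zero  = ∞
... | suc _ = fin 0
ord (suc zero) a = ∞
ord (suc (suc c)) a with ∣ a ∣
... | zero  = ∞
... | suc m = fin (largestPow (suc (suc c)) (suc m) (suc m))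

partialOrd : ℕ → (ℕ → ℤ) → ℕ → ℤ → ℕ∞
partialOrd b a zero    x = fin 0
partialOrd b a (suc i) x = partialOrd b a i x +∞ ord b (x - a i)

Subset : Set₁
Subset = ℤ → Set

Allℤ : Subset
Allℤ _ = ⊤

-- (a_i) is a b-ordering of S: all a_i ∈ S, and for every i ≥ 1 the value
-- Σ_{j<i} ord_b(a_i - a_j) is the minimum over a' ∈ S of Σ_{j<i} ord_b(a' - a_j)
-- (a_i itself lies in S, so the minimum is attained at a_i).
IsBOrdering : Subset → ℕ → (ℕ → ℤ) → Set
IsBOrdering S b a =
  ((i : ℕ) → S (a i)) ×
  ((i : ℕ) → (a' : ℤ) → S a' →
     partialOrd b a (suc i) (a (suc i)) ≤∞ partialOrd b a (suc i) a')

alphaOf : ℕ → (ℕ → ℤ) → ℕ → ℕ∞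
alphaOf b a k = partialOrd b a k (a k)

-- v is α_k(S,b): v is realised by some b-ordering of S
-- (the paper notes that α_k(S,b) does not depend on the b-ordering chosen)
IsAlpha : Subset → ℕ → ℕ → ℕ∞ → Set
IsAlpha S b k v = Σ (ℕ → ℤ) λ a → IsBOrdering S b a × (alphaOf b a k ≡ v)

pow∞ : ℕ → ℕ∞ → ℕ
pow∞ b (fin n)        = b ^ n
pow∞ (suc zero) ∞     = 1
pow∞ zero ∞           = 0
pow∞ (suc (suc _)) ∞  = 0

sumBelow : ℕ → (ℕ → ℕ) → ℕ
sumBelow zero    f = 0
sumBelow (suc n) f = sumBelow n f + f n

prodBelow : ℕ → (ℕ → ℕ) → ℕ
prodBelow zero    f = 1
prodBelow (suc n) f = prodBelow n f * f n

-- ∏_{b=lo}^{hi} f b  (empty product = 1 when hi < lo)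
prodRange : ℕ → ℕ → (ℕ → ℕ) → ℕ
prodRange lo hi f = prodBelow (suc hi ℕ.∸ lo) (λ j → f (lo + j))

IsInfSum₁ : (ℕ → ℕ) → ℕ → Set
IsInfSum₁ f n = Σ ℕ λ N → (M : ℕ) → N ≤ M → sumBelow M (λ i → f (suc i)) ≡ n

IsInfProd : (ℕ → ℕ) → ℕ → Set
IsInfProd f n = Σ ℕ λ N → (M : ℕ) → N ≤ M → prodBelow M f ≡ n

-- floor(k / m) (only used with m = b^i ≥ 1; the m = 0 clause is irrelevant)
floorDiv : ℕ → ℕ → ℕ
floorDiv k zero    = 0
floorDiv k (suc m) = k / suc m

-- For b ≥ 2 we have ord_b(y) = Σ_{m≥1} [b^m ∣ y], hence Σ_{j<k} ord_b(x − a_j) = Σ_{m≥1} h_m(x),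
-- where h_m(x) counts the j < k with a_j ≡ x (mod b^m).  Over any b^m consecutive x these counts
-- add up to k, so while the prefix is balanced (each h_m varies by at most one) every h_m(x) is at
-- least ⌊k/b^m⌋, and refining modulo b, b², … yields a point attaining all these bounds at once.
-- A b-ordering must therefore choose a_k attaining every bound, which keeps the prefix balanced
-- and gives α_k = Σ_m ⌊k/b^m⌋.  The sequence 0, 1, 2, … attains them (h_m(k) counts the multiples
-- of b^m in 1..k), so it is a b-ordering for every b; the factors with b = 0, b = 1 or b > k of
-- the product are 1.

module Submission where

open import Defs
open import Data.Nat using (ℕ; zero; suc; _+_; _*_; _∸_; _^_; _≤_; _<_; _≤?_; z≤n; s≤s; NonZero; >-nonZero)
open import Data.Nat.Properties
open import Data.Nat.DivMod
  using (_/_; _%_; m≡m%n+[m/n]*n; m%n<n; m*n/n≡m; n/1≡n; m<n⇒m/n≡0; /-congʳ; m<n*o⇒m/o<n; m/n/o≡m/[n*o]; /-monoˡ-≤)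
import Data.Nat.Divisibility as ℕᵈ
open import Data.Integer as ℤ using (ℤ; +_; -[1+_]; ∣_∣; _-_)
import Data.Integer.Properties as ℤₚ
open import Data.Integer.Divisibility.Signed
  using (_∣_; _∣?_; ∣ᵤ⇒∣; ∣⇒∣ᵤ; ∣-refl; ∣-trans; ∣m∣n⇒∣m+n; ∣m+n∣n⇒∣m; *-monoˡ-∣; *-cancelʳ-∣)
open import Data.Integer.Tactic.RingSolver using (solve-∀)
open import Data.Product using (Σ; _×_; _,_; ∃-syntax)
open import Data.Sum using (_⊎_; inj₁; inj₂; [_,_]′)
open import Data.Empty using (⊥-elim)
open import Relation.Nullary using (Dec; yes; no; ¬_)
open import Relation.Binary.PropositionalEquality
open import Algebra.Properties.CommutativeSemigroup +-commutativeSemigroup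
  using () renaming (interchange to +-interchange)

iverson : {P : Set} → Dec P → ℕ
iverson (yes _) = 1
iverson (no _)  = 0

iverson-yes : {P : Set} (p? : Dec P) → P → iverson p? ≡ 1
iverson-yes (yes _) _ = refl
iverson-yes (no ¬p) p = ⊥-elim (¬p p)

iverson-no : {P : Set} (p? : Dec P) → ¬ P → iverson p? ≡ 0
iverson-no (yes p) ¬p = ⊥-elim (¬p p)
iverson-no (no _)  _  = refl

iverson-mono : {P Q : Set} → (P → Q) → (p? : Dec P) (q? : Dec Q) → iverson p? ≤ iverson q?
iverson-mono P⇒Q (yes p) (yes _) = ≤-refl
iverson-mono P⇒Q (yes p) (no ¬q) = ⊥-elim (¬q (P⇒Q p))
iverson-mono P⇒Q (no _)  _       = z≤n

iverson-cong : {P Q : Set} → (P → Q) → (Q → P) → (p? : Dec P) (q? : Dec Q) → iverson p? ≡ iverson q?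
iverson-cong P⇒Q Q⇒P p? q? = ≤-antisym (iverson-mono P⇒Q p? q?) (iverson-mono Q⇒P q? p?)

module _ {f g : ℕ → ℕ} where

  sumBelow-cong : ∀ n → (∀ i → i < n → f i ≡ g i) → sumBelow n f ≡ sumBelow n g
  sumBelow-cong zero    f≡g = refl
  sumBelow-cong (suc n) f≡g =
    cong₂ _+_ (sumBelow-cong n λ i i<n → f≡g i (m<n⇒m<1+n i<n)) (f≡g n ≤-refl)

  sumBelow-mono : ∀ n → (∀ i → i < n → f i ≤ g i) → sumBelow n f ≤ sumBelow n g
  sumBelow-mono zero    f≤g = z≤n
  sumBelow-mono (suc n) f≤g =
    +-mono-≤ (sumBelow-mono n λ i i<n → f≤g i (m<n⇒m<1+n i<n)) (f≤g n ≤-refl)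

  sumBelow-mono-tight : ∀ n → (∀ i → i < n → f i ≤ g i) → sumBelow n g ≤ sumBelow n f →
                    ∀ i → i < n → f i ≡ g i
  sumBelow-mono-tight (suc n) f≤g Σg≤Σf i i<1+n with m<1+n⇒m<n∨m≡n i<1+n
  ... | inj₁ i<n  = sumBelow-mono-tight n f≤g′ (≤-reflexive (sym Σf≡Σg)) i i<n
    where
    f≤g′ : ∀ i → i < n → f i ≤ g i
    f≤g′ i i<n = f≤g i (m<n⇒m<1+n i<n)
    Σf≡Σg : sumBelow n f ≡ sumBelow n g
    Σf≡Σg = ≤-antisym (sumBelow-mono n f≤g′)
      (+-cancelʳ-≤ (f n) _ _ (≤-trans (+-monoʳ-≤ (sumBelow n g) (f≤g n ≤-refl)) Σg≤Σf))
  ... | inj₂ refl = ≤-antisym (f≤g n ≤-refl)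
      (+-cancelˡ-≤ (sumBelow n f) _ _ (≤-trans (+-monoˡ-≤ (g n) Σf≤Σg) Σg≤Σf))
    where
    Σf≤Σg : sumBelow n f ≤ sumBelow n g
    Σf≤Σg = sumBelow-mono n λ i i<n → f≤g i (m<n⇒m<1+n i<n)

sumBelow-const : ∀ n c → sumBelow n (λ _ → c) ≡ n * c
sumBelow-const zero    c = refl
sumBelow-const (suc n) c = trans (cong (_+ c) (sumBelow-const n c)) (+-comm (n * c) c)

sumBelow-zero : ∀ n {f : ℕ → ℕ} → (∀ i → i < n → f i ≡ 0) → sumBelow n f ≡ 0
sumBelow-zero n f≡0 = trans (sumBelow-cong n f≡0) (trans (sumBelow-const n 0) (*-zeroʳ n))

sumBelow-ones : ∀ n {f : ℕ → ℕ} → (∀ i → i < n → f i ≡ 1) → sumBelow n f ≡ n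
sumBelow-ones n f≡1 = trans (sumBelow-cong n f≡1) (trans (sumBelow-const n 1) (*-identityʳ n))

sumBelow-≤-* : ∀ n c {f : ℕ → ℕ} → (∀ i → i < n → f i ≤ c) → sumBelow n f ≤ n * c
sumBelow-≤-* n c f≤c = subst (_ ≤_) (sumBelow-const n c) (sumBelow-mono n f≤c)

*-≤-sumBelow : ∀ n c {f : ℕ → ℕ} → (∀ i → i < n → c ≤ f i) → n * c ≤ sumBelow n f
*-≤-sumBelow n c c≤f = subst (_≤ _) (sumBelow-const n c) (sumBelow-mono n c≤f)

≤-sumBelow : ∀ n (f : ℕ → ℕ) {i} → i < n → f i ≤ sumBelow n f
≤-sumBelow (suc n) f i<1+n with m<1+n⇒m<n∨m≡n i<1+n
... | inj₁ i<n  = ≤-trans (≤-sumBelow n f i<n) (m≤m+n _ _)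
... | inj₂ refl = m≤n+m _ _

sumBelow-suc : ∀ n (f : ℕ → ℕ) → sumBelow (suc n) f ≡ f 0 + sumBelow n (λ i → f (suc i))
sumBelow-suc zero    f = +-comm 0 (f 0)
sumBelow-suc (suc n) f = trans (cong (_+ f (suc n)) (sumBelow-suc n f)) (+-assoc (f 0) _ _)

sumBelow-+ : ∀ n (f g : ℕ → ℕ) → sumBelow n (λ i → f i + g i) ≡ sumBelow n f + sumBelow n g
sumBelow-+ zero    f g = refl
sumBelow-+ (suc n) f g = trans (cong (_+ (f n + g n)) (sumBelow-+ n f g))
                               (+-interchange (sumBelow n f) (sumBelow n g) (f n) (g n))

sumBelow-swap : ∀ n m (f : ℕ → ℕ → ℕ) →
  sumBelow n (λ i → sumBelow m (f i)) ≡ sumBelow m (λ j → sumBelow n (λ i → f i j))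
sumBelow-swap zero    m f = sym (sumBelow-zero m λ _ _ → refl)
sumBelow-swap (suc n) m f = trans (cong (_+ sumBelow m (f n)) (sumBelow-swap n m f))
                                  (sym (sumBelow-+ m (λ j → sumBelow n (λ i → f i j)) (f n)))

sumBelow-++ : ∀ m n (f : ℕ → ℕ) → sumBelow (m + n) f ≡ sumBelow m f + sumBelow n (λ i → f (m + i))
sumBelow-++ m zero    f = trans (cong (λ l → sumBelow l f) (+-identityʳ m)) (sym (+-identityʳ _))
sumBelow-++ m (suc n) f = trans (cong (λ l → sumBelow l f) (+-suc m n))
  (trans (cong (_+ f (m + n)) (sumBelow-++ m n f)) (+-assoc (sumBelow m f) _ _))

sumBelow-reverse : ∀ n (f : ℕ → ℕ) → sumBelow n (λ j → f (n ∸ j)) ≡ sumBelow n (λ j → f (suc j))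
sumBelow-reverse zero    f = refl
sumBelow-reverse (suc n) f = begin
  sumBelow n (λ j → f (suc n ∸ j)) + f (suc n ∸ n)
    ≡⟨ cong₂ _+_ (sumBelow-cong n λ j j<n → cong f (+-∸-assoc 1 (<⇒≤ j<n))) (cong f (m+n∸n≡m 1 n)) ⟩
  sumBelow n (λ j → f (suc (n ∸ j))) + f 1
    ≡⟨ cong (_+ f 1) (sumBelow-reverse n (λ i → f (suc i))) ⟩
  sumBelow n (λ j → f (suc (suc j))) + f 1
    ≡⟨ +-comm _ (f 1) ⟩
  f 1 + sumBelow n (λ j → f (suc (suc j)))
    ≡⟨ sumBelow-suc n (λ j → f (suc j)) ⟨
  sumBelow (suc n) (λ j → f (suc j)) ∎
  where open ≡-Reasoning

sumBelow-eventually-zero : ∀ {K} M {f : ℕ → ℕ} → K ≤ M → (∀ i → K ≤ i → f i ≡ 0) →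
                           sumBelow M f ≡ sumBelow K f
sumBelow-eventually-zero zero    z≤n f≡0 = refl
sumBelow-eventually-zero (suc M) K≤1+M f≡0 with m≤n⇒m<n∨m≡n K≤1+M
... | inj₁ K<1+M = trans (cong₂ _+_ (sumBelow-eventually-zero M (≤-pred K<1+M) f≡0)
                                    (f≡0 M (≤-pred K<1+M)))
                         (+-identityʳ _)
... | inj₂ refl  = refl

sumBelow-prefix-ones : ∀ N L {f : ℕ → ℕ} → L ≤ N → (∀ i → i < L → f i ≡ 1) →
                       (∀ i → L ≤ i → f i ≡ 0) → sumBelow N f ≡ L
sumBelow-prefix-ones N L L≤N f≡1 f≡0 =
  trans (sumBelow-eventually-zero N L≤N f≡0) (sumBelow-ones L f≡1)

some-term-≤-average : ∀ n (f : ℕ → ℕ) → 0 < n → ∃[ t ] t < n × n * f t ≤ sumBelow n f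
some-term-≤-average n f 0<n with argmin n 0<n
  where
  argmin : ∀ n → 0 < n → ∃[ t ] t < n × (∀ s → s < n → f t ≤ f s)
  argmin (suc zero)    _ = 0 , ≤-refl , λ { .0 (s≤s z≤n) → ≤-refl }
  argmin (suc (suc n)) _ with argmin (suc n) (s≤s z≤n)
  ... | t , t<1+n , min with f t ≤? f (suc n)
  ...   | yes ft≤ = t , m<n⇒m<1+n t<1+n ,
                    λ s s< → [ min s , (λ { refl → ft≤ }) ]′ (m<1+n⇒m<n∨m≡n s<)
  ...   | no  ft≰ = suc n , ≤-refl ,
                    λ s s< → [ (λ s<1+n → ≤-trans (<⇒≤ (≰⇒> ft≰)) (min s s<1+n))
                             , (λ { refl → ≤-refl }) ]′ (m<1+n⇒m<n∨m≡n s<)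
... | t , t<n , min = t , t<n , *-≤-sumBelow n (f t) min

prodBelow-suc : ∀ n (f : ℕ → ℕ) → prodBelow (suc n) f ≡ f 0 * prodBelow n (λ i → f (suc i))
prodBelow-suc zero    f = *-comm 1 (f 0)
prodBelow-suc (suc n) f = trans (cong (_* f (suc n)) (prodBelow-suc n f)) (*-assoc (f 0) _ _)

prodBelow-eventually-one : ∀ {K} M {f : ℕ → ℕ} → K ≤ M → (∀ i → K ≤ i → f i ≡ 1) →
                           prodBelow M f ≡ prodBelow K f
prodBelow-eventually-one zero    z≤n f≡1 = refl
prodBelow-eventually-one (suc M) K≤1+M f≡1 with m≤n⇒m<n∨m≡n K≤1+M
... | inj₁ K<1+M = trans (cong₂ _*_ (prodBelow-eventually-one M (≤-pred K<1+M) f≡1)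
                                    (f≡1 M (≤-pred K<1+M)))
                         (*-identityʳ _)
... | inj₂ refl  = refl

[x+t]-y≡[x-y]+t : ∀ x t y → (x ℤ.+ t) - y ≡ (x - y) ℤ.+ t
[x+t]-y≡[x-y]+t = solve-∀

x-y≡[x′-y]+[x-x′] : ∀ x x′ y → x - y ≡ (x′ - y) ℤ.+ (x - x′)
x-y≡[x′-y]+[x-x′] = solve-∀

[x+t]-x≡t : ∀ x t → (x ℤ.+ t) - x ≡ t
[x+t]-x≡t = solve-∀

divides : ℕ → ℤ → ℕ
divides d y = iverson (+ d ∣? y)

divides-cong : ∀ {d e y z} → (+ d ∣ y → + e ∣ z) → (+ e ∣ z → + d ∣ y) → divides d y ≡ divides e z
divides-cong d∣y⇒e∣z e∣z⇒d∣y = iverson-cong d∣y⇒e∣z e∣z⇒d∣y _ _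

divides-+-multiple : ∀ d y {z} → + d ∣ z → divides d (y ℤ.+ z) ≡ divides d y
divides-+-multiple d y {z} d∣z =
  divides-cong (λ d∣y+z → ∣m+n∣n⇒∣m d∣y+z d∣z) (λ d∣y → ∣m∣n⇒∣m+n d∣y d∣z)

divides-window : ∀ d .{{_ : NonZero d}} z → sumBelow d (λ t → divides d (z ℤ.+ + t)) ≡ 1
divides-window (suc e) = window
  where
  d = suc e
  W : ℤ → ℕ
  W z = sumBelow d (λ t → divides d (z ℤ.+ + t))

  shift : ∀ z → W (z ℤ.+ + 1) ≡ W z
  shift z = begin
    sumBelow e (λ t → divides d (z ℤ.+ + 1 ℤ.+ + t)) + divides d (z ℤ.+ + 1 ℤ.+ + e)
      ≡⟨ cong₂ _+_ (sumBelow-cong e λ t _ → cong (divides d) (ℤₚ.+-assoc z (+ 1) (+ t))) wrap ⟩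
    sumBelow e (λ t → divides d (z ℤ.+ + suc t)) + divides d (z ℤ.+ + 0)
      ≡⟨ +-comm (sumBelow e (λ t → divides d (z ℤ.+ + suc t))) _ ⟩
    divides d (z ℤ.+ + 0) + sumBelow e (λ t → divides d (z ℤ.+ + suc t))
      ≡⟨ sumBelow-suc e (λ t → divides d (z ℤ.+ + t)) ⟨
    W z ∎
    where
    open ≡-Reasoning
    wrap : divides d (z ℤ.+ + 1 ℤ.+ + e) ≡ divides d (z ℤ.+ + 0)
    wrap = trans (cong (divides d) (ℤₚ.+-assoc z (+ 1) (+ e)))
                 (trans (divides-+-multiple d z ∣-refl) (cong (divides d) (sym (ℤₚ.+-identityʳ z))))

  origin : W (+ 0) ≡ 1
  origin = trans (sumBelow-suc e (λ t → divides d (+ t)))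
                 (cong₂ _+_ (iverson-yes (+ d ∣? + 0) (∣ᵤ⇒∣ (d ℕᵈ.∣0)))
                            (sumBelow-zero e λ t t<e → iverson-no (+ d ∣? + suc t)
                              λ d∣1+t → ℕᵈ.>⇒∤ (s≤s t<e) (∣⇒∣ᵤ d∣1+t)))

  window : ∀ z → W z ≡ 1
  window (+ zero)       = origin
  window (+ suc n)      = trans (cong (λ m → W (+ m)) (+-comm 1 n)) (trans (shift (+ n)) (window (+ n)))
  window -[1+ zero ]    = trans (sym (shift -[1+ 0 ])) origin
  window -[1+ suc n ]   = trans (sym (shift -[1+ suc n ])) (window -[1+ n ])

divides-split : ∀ p q .{{_ : NonZero p}} .{{_ : NonZero q}} y →
                divides p y ≡ sumBelow q (λ t → divides (q * p) (y ℤ.+ + (t * p)))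
divides-split p q y with + p ∣? y
... | yes p∣y = sym (trans (sumBelow-cong q λ t _ → rescale t) (divides-window q u))
  where
  u = _∣_.quotient p∣y
  y+tp≡[u+t]p : ∀ t → y ℤ.+ + (t * p) ≡ (u ℤ.+ + t) ℤ.* + p
  y+tp≡[u+t]p t = trans (cong₂ ℤ._+_ (_∣_.equality p∣y) (ℤₚ.pos-* t p))
                        (sym (ℤₚ.*-distribʳ-+ (+ p) u (+ t)))
  rescale : ∀ t → divides (q * p) (y ℤ.+ + (t * p)) ≡ divides q (u ℤ.+ + t)
  rescale t = trans (cong (divides (q * p)) (y+tp≡[u+t]p t)) (divides-cong
    (λ qp∣ → *-cancelʳ-∣ (+ p) (subst (_∣ _) (ℤₚ.pos-* q p) qp∣))
    (λ q∣ → subst (_∣ _) (sym (ℤₚ.pos-* q p)) (*-monoˡ-∣ (+ p) q∣)))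
... | no p∤y = sym (sumBelow-zero q λ t _ → iverson-no _ λ qp∣y+tp →
                 p∤y (∣m+n∣n⇒∣m (∣-trans (∣ᵤ⇒∣ (ℕᵈ.n∣m*n q)) qp∣y+tp)
                                (∣ᵤ⇒∣ (ℕᵈ.n∣m*n t))))

multiples-count : ∀ d .{{_ : NonZero d}} k → sumBelow k (λ j → divides d (+ suc j)) ≡ k / d
multiples-count d k = begin
  M k                           ≡⟨ cong M (m≡m%n+[m/n]*n k d) ⟩
  M (k % d + (k / d) * d)       ≡⟨ periodic (k % d) (k / d) (m%n<n k d) ⟩
  k / d                         ∎
  where
  open ≡-Reasoning
  M : ℕ → ℕ
  M k = sumBelow k (λ j → divides d (+ suc j))
  M-+d : ∀ n → M (n + d) ≡ M n + 1
  M-+d n = trans (sumBelow-++ n d _) (cong (λ s → M n + s) (divides-window d (+ suc n)))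
  periodic : ∀ r q → r < d → M (r + q * d) ≡ q
  periodic r zero    r<d = trans (cong M (+-identityʳ r))
    (sumBelow-zero r λ j j<r → iverson-no _ λ d∣1+j → ℕᵈ.>⇒∤ (≤-<-trans j<r r<d) (∣⇒∣ᵤ d∣1+j))
  periodic r (suc q) r<d = begin
    M (r + (d + q * d))    ≡⟨ cong M (trans (cong (λ s → r + s) (+-comm d (q * d))) (sym (+-assoc r (q * d) d))) ⟩
    M (r + q * d + d)      ≡⟨ M-+d (r + q * d) ⟩
    M (r + q * d) + 1      ≡⟨ cong (_+ 1) (periodic r q r<d) ⟩
    q + 1                  ≡⟨ +-comm q 1 ⟩
    suc q                  ∎

^-monoʳ-∣ : ∀ d {m n} → m ≤ n → d ^ m ℕᵈ.∣ d ^ n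
^-monoʳ-∣ d {m} {n} m≤n =
  ℕᵈ.divides (d ^ (n ∸ m)) (trans (cong (d ^_) (sym (m∸n+n≡m m≤n))) (^-distribˡ-+-* d (n ∸ m) m))

largestPow-∣ : ∀ d n B → d ^ largestPow d n B ℕᵈ.∣ n
largestPow-∣ d n zero    = ℕᵈ.1∣ n
largestPow-∣ d n (suc B) with d ^ suc B ℕᵈ.∣? n
... | yes d^B∣n = d^B∣n
... | no  _     = largestPow-∣ d n B

largestPow-maximal : ∀ d n B {m} → m ≤ B → d ^ m ℕᵈ.∣ n → m ≤ largestPow d n B
largestPow-maximal d n zero    z≤n _ = z≤n
largestPow-maximal d n (suc B) m≤1+B d^m∣n with d ^ suc B ℕᵈ.∣? n
... | yes _ = m≤1+B
... | no d^B∤n with m≤n⇒m<n∨m≡n m≤1+B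
...   | inj₁ m<1+B = largestPow-maximal d n B (≤-pred m<1+B) d^m∣n
...   | inj₂ refl  = ⊥-elim (d^B∤n d^m∣n)

largestPow-≤ : ∀ d n B → largestPow d n B ≤ B
largestPow-≤ d n zero    = z≤n
largestPow-≤ d n (suc B) with d ^ suc B ℕᵈ.∣? n
... | yes _ = ≤-refl
... | no  _ = m≤n⇒m≤1+n (largestPow-≤ d n B)

+k-+j≡+[k∸j] : ∀ {j k} → j ≤ k → + k - + j ≡ + (k ∸ j)
+k-+j≡+[k∸j] {j} {k} j≤k = trans (ℤₚ.m-n≡m⊖n k j) (ℤₚ.⊖-≥ j≤k)

+k-+j≢0 : ∀ k j → j < k → ∣ + k - + j ∣ ≢ 0
+k-+j≢0 k j j<k ∣k-j∣≡0 =
  n>0⇒n≢0 (m<n⇒0<n∸m j<k) (subst (λ z → ∣ z ∣ ≡ 0) (+k-+j≡+[k∸j] (<⇒≤ j<k)) ∣k-j∣≡0)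

naturals : ℕ → ℤ
naturals n = + n

module Radix (c : ℕ) where

  b : ℕ
  b = suc (suc c)

  b^≢0 : ∀ m → NonZero (b ^ m)
  b^≢0 m = m^n≢0 b m

  n<b^n : ∀ n → n < b ^ n
  n<b^n zero    = s≤s z≤n
  n<b^n (suc n) = +-mono-≤ (m^n>0 b n) (≤-trans (n<b^n n) (m≤m+n _ _))

  infixl 7 _/b^_
  _/b^_ : ℕ → ℕ → ℕ
  k /b^ m = _/_ k (b ^ m) {{b^≢0 m}}

  /b^-vanishes : ∀ k {m} → k ≤ m → k /b^ m ≡ 0
  /b^-vanishes k {m} k≤m = m<n⇒m/n≡0 {{b^≢0 m}} (<-≤-trans (n<b^n k) (^-monoʳ-≤ b k≤m))

  /b^-/b : ∀ k m → k /b^ m / b ≡ k /b^ suc m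
  /b^-/b k m = trans (m/n/o≡m/[n*o] k (b ^ m) b {{b^≢0 m}} {{_}} {{b^m*b≢0}})
                     (/-congʳ {{b^m*b≢0}} {{b^≢0 (suc m)}} (*-comm (b ^ m) b))
    where
    b^m*b≢0 : NonZero (b ^ m * b)
    b^m*b≢0 = m*n≢0 (b ^ m) b {{b^≢0 m}}

  floorSum : ℕ → ℕ
  floorSum k = sumBelow k (λ i → k /b^ suc i)

  floorSum-extend : ∀ {k} N → k ≤ N → sumBelow N (λ i → k /b^ suc i) ≡ floorSum k
  floorSum-extend {k} N k≤N = sumBelow-eventually-zero N k≤N λ i k≤i → /b^-vanishes k (m≤n⇒m≤1+n k≤i)

  ord≡fin-inv : ∀ y {o} → ord b y ≡ fin o →
            0 < ∣ y ∣ × o ≡ largestPow b ∣ y ∣ ∣ y ∣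
  ord≡fin-inv y with ∣ y ∣
  ... | zero  = λ ()
  ... | suc n = λ { refl → s≤s z≤n , refl }

  ord-as-sumBelow : ∀ y {o} N → ord b y ≡ fin o → ∣ y ∣ ≤ N →
                    o ≡ sumBelow N (λ i → divides (b ^ suc i) y)
  ord-as-sumBelow y N ord≡o y≤N with ord≡fin-inv y ord≡o
  ... | 0<y , refl =
    sym (sumBelow-prefix-ones N L (≤-trans (largestPow-≤ b ∣ y ∣ ∣ y ∣) y≤N) below above)
    where
    L = largestPow b ∣ y ∣ ∣ y ∣
    below : ∀ i → i < L → divides (b ^ suc i) y ≡ 1
    below i i<L = iverson-yes _ (∣ᵤ⇒∣ (ℕᵈ.∣-trans (^-monoʳ-∣ b i<L) (largestPow-∣ b ∣ y ∣ ∣ y ∣)))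
    above : ∀ i → L ≤ i → divides (b ^ suc i) y ≡ 0
    above i L≤i = iverson-no _ λ b^i∣y →
      let b^i∣n = ∣⇒∣ᵤ b^i∣y
          i<n   = <⇒≤ (<-≤-trans (n<b^n (suc i)) (ℕᵈ.∣⇒≤ {{>-nonZero 0<y}} b^i∣n))
      in <⇒≱ (s≤s L≤i) (largestPow-maximal b ∣ y ∣ ∣ y ∣ i<n b^i∣n)

  ord-finite : ∀ y → ∣ y ∣ ≢ 0 → ∃[ o ] ord b y ≡ fin o
  ord-finite y y≢0 with ∣ y ∣
  ... | zero  = ⊥-elim (y≢0 refl)
  ... | suc _ = _ , refl

  module Hits (a : ℕ → ℤ) where

    hits : ℕ → ℕ → ℤ → ℕ
    hits m k x = sumBelow k (λ j → divides (b ^ m) (x - a j))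

    Balanced : ℕ → Set
    Balanced k = ∀ m x y → hits m k x ≤ suc (hits m k y)

    AttainsMinima : ℕ → ℤ → Set
    AttainsMinima k x = ∀ m → hits m k x ≡ k /b^ m

    cutoff : ℕ → ℤ → ℕ
    cutoff k x = k + sumBelow k (λ j → ∣ x - a j ∣)

    k≤cutoff : ∀ k x → k ≤ cutoff k x
    k≤cutoff k x = m≤m+n k _

    ≤-cutoff : ∀ k x j → j < k → ∣ x - a j ∣ ≤ cutoff k x
    ≤-cutoff k x j j<k = ≤-trans (≤-sumBelow k (λ j → ∣ x - a j ∣) j<k) (m≤n+m _ k)

    hits-zero : ∀ k x → hits 0 k x ≡ k
    hits-zero k x = sumBelow-ones k λ j _ → iverson-yes _ (∣ᵤ⇒∣ (ℕᵈ.1∣ _))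

    hits-antitone : ∀ {m m′} k x → m ≤ m′ → hits m′ k x ≤ hits m k x
    hits-antitone k x m≤m′ =
      sumBelow-mono k λ j _ → iverson-mono (∣-trans (∣ᵤ⇒∣ (^-monoʳ-∣ b m≤m′))) _ _

    hits-cong : ∀ m k x x′ → + (b ^ m) ∣ x - x′ → hits m k x ≡ hits m k x′
    hits-cong m k x x′ b^m∣x-x′ = sumBelow-cong k λ j _ →
      trans (cong (divides (b ^ m)) (x-y≡[x′-y]+[x-x′] x x′ (a j)))
            (divides-+-multiple (b ^ m) (x′ - a j) b^m∣x-x′)

    hits-window : ∀ m k x → sumBelow (b ^ m) (λ t → hits m k (x ℤ.+ + t)) ≡ k
    hits-window m k x = begin
      sumBelow (b ^ m) (λ t → hits m k (x ℤ.+ + t))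
        ≡⟨ sumBelow-swap (b ^ m) k _ ⟩
      sumBelow k (λ j → sumBelow (b ^ m) (λ t → divides (b ^ m) ((x ℤ.+ + t) - a j)))
        ≡⟨ sumBelow-ones k window-j ⟩
      k ∎
      where
      open ≡-Reasoning
      window-j : ∀ j → j < k → sumBelow (b ^ m) (λ t → divides (b ^ m) ((x ℤ.+ + t) - a j)) ≡ 1
      window-j j _ = trans (sumBelow-cong (b ^ m) λ t _ → cong (divides (b ^ m)) ([x+t]-y≡[x-y]+t x (+ t) (a j)))
                           (divides-window (b ^ m) {{b^≢0 m}} (x - a j))

    hits-split : ∀ m k x → sumBelow b (λ t → hits (suc m) k (x ℤ.+ + (t * b ^ m))) ≡ hits m k x
    hits-split m k x = begin
      sumBelow b (λ t → hits (suc m) k (x ℤ.+ + (t * b ^ m)))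
        ≡⟨ sumBelow-swap b k _ ⟩
      sumBelow k (λ j → sumBelow b (λ t → divides (b ^ suc m) ((x ℤ.+ + (t * b ^ m)) - a j)))
        ≡⟨ sumBelow-cong k split-j ⟩
      hits m k x ∎
      where
      open ≡-Reasoning
      split-j : ∀ j → j < k → sumBelow b (λ t → divides (b ^ suc m) ((x ℤ.+ + (t * b ^ m)) - a j))
                              ≡ divides (b ^ m) (x - a j)
      split-j j _ = trans (sumBelow-cong b λ t _ → cong (divides (b ^ suc m)) ([x+t]-y≡[x-y]+t x _ (a j)))
                          (sym (divides-split (b ^ m) b {{b^≢0 m}} (x - a j)))

    -- Over b^m consecutive points the hits add up to k, and balance bounds each of them by hits x + 1.
    hits-lower : ∀ {k} → Balanced k → ∀ m x → k /b^ m ≤ hits m k x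
    hits-lower {k} balanced m x = ≤-pred (m<n*o⇒m/o<n {{b^≢0 m}} k<[h+1]b^m)
      where
      h = hits m k x
      d-1 = b ^ m ∸ 1
      d≡1+d-1 : b ^ m ≡ suc d-1
      d≡1+d-1 = sym (m+[n∸m]≡n (m^n>0 b m))
      g : ℕ → ℕ
      g t = hits m k (x ℤ.+ + t)
      k≤h+[d-1][h+1] : k ≤ h + d-1 * suc h
      k≤h+[d-1][h+1] = begin
        k                                      ≡⟨ hits-window m k x ⟨
        sumBelow (b ^ m) g                     ≡⟨ cong (λ d → sumBelow d g) d≡1+d-1 ⟩
        sumBelow (suc d-1) g                   ≡⟨ sumBelow-suc d-1 g ⟩
        g 0 + sumBelow d-1 (λ t → g (suc t))   ≤⟨ +-mono-≤ (≤-reflexive (cong (hits m k) (ℤₚ.+-identityʳ x)))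
                                                          (sumBelow-≤-* d-1 (suc h) λ t _ → balanced m (x ℤ.+ + suc t) x) ⟩
        h + d-1 * suc h                        ∎
        where open ≤-Reasoning
      k<[h+1]b^m : k < suc h * b ^ m
      k<[h+1]b^m = begin-strict
        k                    ≤⟨ k≤h+[d-1][h+1] ⟩
        h + d-1 * suc h      <⟨ s≤s ≤-refl ⟩
        suc d-1 * suc h      ≡⟨ cong (_* suc h) (sym d≡1+d-1) ⟩
        b ^ m * suc h        ≡⟨ *-comm (b ^ m) (suc h) ⟩
        suc h * b ^ m        ∎
        where open ≤-Reasoning

    -- Refining a point attaining the minima up to level M by the best of its b lifts mod b^(M+1):
    -- some lift is at most the average ⌊k/b^M⌋ / b of their hits, which is ⌊k/b^(M+1)⌋.
    hits-refine : ∀ {k} → Balanced k → ∀ M → ∃[ w ] (∀ m → m ≤ M → hits m k w ≡ k /b^ m)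
    hits-refine {k} balanced zero =
      + 0 , λ { .zero z≤n → trans (hits-zero k (+ 0)) (sym (n/1≡n k)) }
    hits-refine {k} balanced (suc M) with hits-refine balanced M
    ... | w , w-min with some-term-≤-average b (λ t → hits (suc M) k (w ℤ.+ + (t * b ^ M))) (s≤s z≤n)
    ...   | t , _ , b*h≤Σ = w′ , w′-min
      where
      w′ = w ℤ.+ + (t * b ^ M)
      h = hits (suc M) k w′
      h≤ : h ≤ k /b^ suc M
      h≤ = begin
        h                   ≡⟨ m*n/n≡m h b ⟨
        h * b / b           ≤⟨ /-monoˡ-≤ b (subst (_≤ k /b^ M) (*-comm b h)
                                 (subst (b * h ≤_) (trans (hits-split M k w) (w-min M ≤-refl)) b*h≤Σ)) ⟩
        k /b^ M / b         ≡⟨ /b^-/b k M ⟩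
        k /b^ suc M         ∎
        where open ≤-Reasoning
      w′-min : ∀ m → m ≤ suc M → hits m k w′ ≡ k /b^ m
      w′-min m m≤1+M with m≤n⇒m<n∨m≡n m≤1+M
      ... | inj₂ refl   = ≤-antisym h≤ (hits-lower balanced (suc M) w′)
      ... | inj₁ m<1+M  = trans (hits-cong m k w′ w b^m∣w′-w) (w-min m (≤-pred m<1+M))
        where
        b^m∣w′-w : + (b ^ m) ∣ w′ - w
        b^m∣w′-w = subst (_ ∣_) (sym ([x+t]-x≡t w _))
                         (∣ᵤ⇒∣ (ℕᵈ.∣n⇒∣m*n t (^-monoʳ-∣ b (≤-pred m<1+M))))

    attaining-point : ∀ {k} → Balanced k → ∃[ w ] AttainsMinima k w
    attaining-point {k} balanced with hits-refine balanced k
    ... | w , w-min = w , λ m → [ w-min m , above m ]′ (≤-total m k)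
      where
      above : ∀ m → k ≤ m → hits m k w ≡ k /b^ m
      above m k≤m = trans (n≤0⇒n≡0 (begin
        hits m k w  ≤⟨ hits-antitone k w k≤m ⟩
        hits k k w  ≡⟨ w-min k ≤-refl ⟩
        k /b^ k     ≡⟨ /b^-vanishes k ≤-refl ⟩
        0           ∎)) (sym (/b^-vanishes k k≤m))
        where open ≤-Reasoning

    balanced-suc : ∀ {k} → Balanced k → AttainsMinima k (a k) → Balanced (suc k)
    balanced-suc {k} balanced aₖ-min m x y with + (b ^ m) ∣? (x - a k)
    ... | yes b^m∣x-aₖ = begin
      hits m k x + 1           ≡⟨ cong (_+ 1) (trans (hits-cong m k x (a k) b^m∣x-aₖ) (aₖ-min m)) ⟩
      k /b^ m + 1              ≤⟨ +-monoˡ-≤ 1 (hits-lower balanced m y) ⟩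
      hits m k y + 1           ≡⟨ +-comm (hits m k y) 1 ⟩
      suc (hits m k y)         ≤⟨ s≤s (m≤m+n _ _) ⟩
      suc (hits m (suc k) y)   ∎
      where open ≤-Reasoning
    ... | no _ = begin
      hits m k x + 0           ≡⟨ +-identityʳ _ ⟩
      hits m k x               ≤⟨ balanced m x y ⟩
      suc (hits m k y)         ≤⟨ s≤s (m≤m+n _ _) ⟩
      suc (hits m (suc k) y)   ∎
      where open ≤-Reasoning

    partialOrd-as-hits : ∀ k x {n} N → partialOrd b a k x ≡ fin n → (∀ j → j < k → ∣ x - a j ∣ ≤ N) →
                         n ≡ sumBelow N (λ i → hits (suc i) k x)
    partialOrd-as-hits k x N ≡n bounded = trans (by-term k ≡n bounded) (sumBelow-swap k N _)
      where
      by-term : ∀ k {n} → partialOrd b a k x ≡ fin n → (∀ j → j < k → ∣ x - a j ∣ ≤ N) →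
                n ≡ sumBelow k (λ j → sumBelow N (λ i → divides (b ^ suc i) (x - a j)))
      by-term zero    refl _ = refl
      by-term (suc k) ≡n bounded with partialOrd b a k x in ≡n₁ | ord b (x - a k) in ≡n₂ | ≡n
      ... | fin n₁ | fin n₂ | refl =
        cong₂ _+_ (by-term k ≡n₁ λ j j<k → bounded j (m<n⇒m<1+n j<k))
                  (ord-as-sumBelow (x - a k) N ≡n₂ (bounded k ≤-refl))

    partialOrd-finite : ∀ k x → (∀ j → j < k → ∣ x - a j ∣ ≢ 0) → ∃[ n ] partialOrd b a k x ≡ fin n
    partialOrd-finite zero    x distinct = 0 , refl
    partialOrd-finite (suc k) x distinct
      with partialOrd-finite k x (λ j j<k → distinct j (m<n⇒m<1+n j<k)) | ord-finite (x - a k) (distinct k ≤-refl)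
    ... | n₁ , ≡n₁ | n₂ , ≡n₂ rewrite ≡n₁ | ≡n₂ = n₁ + n₂ , refl

    attaining-distinct : ∀ k x → AttainsMinima k x → ∀ j → j < k → ∣ x - a j ∣ ≢ 0
    attaining-distinct k x x-min j j<k ∣x-aⱼ∣≡0 = 1+n≰n (begin
      1                         ≡⟨ iverson-yes _ b^k∣x-aⱼ ⟨
      divides (b ^ k) (x - a j) ≤⟨ ≤-sumBelow k (λ j → divides (b ^ k) (x - a j)) j<k ⟩
      hits k k x                ≡⟨ trans (x-min k) (/b^-vanishes k ≤-refl) ⟩
      0                         ∎)
      where
      open ≤-Reasoning
      b^k∣x-aⱼ : + (b ^ k) ∣ x - a j
      b^k∣x-aⱼ = subst (_ ∣_) (sym (ℤₚ.∣i∣≡0⇒i≡0 ∣x-aⱼ∣≡0)) (∣ᵤ⇒∣ (_ ℕᵈ.∣0))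

    partialOrd-attaining : ∀ k x → AttainsMinima k x → partialOrd b a k x ≡ fin (floorSum k)
    partialOrd-attaining k x x-min with partialOrd-finite k x (attaining-distinct k x x-min)
    ... | n , ≡n = trans ≡n (cong fin (begin
      n                                      ≡⟨ partialOrd-as-hits k x N ≡n (≤-cutoff k x) ⟩
      sumBelow N (λ i → hits (suc i) k x)    ≡⟨ sumBelow-cong N (λ i _ → x-min (suc i)) ⟩
      sumBelow N (λ i → k /b^ suc i)         ≡⟨ floorSum-extend N (k≤cutoff k x) ⟩
      floorSum k                             ∎))
      where
      open ≡-Reasoning
      N = cutoff k x

    partialOrd-lower : ∀ {k} → Balanced k → ∀ x → fin (floorSum k) ≤∞ partialOrd b a k x
    partialOrd-lower {k} balanced x with partialOrd b a k x in ≡n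
    ... | ∞     = _ ≤∞∞
    ... | fin n = fin≤fin (begin
      floorSum k                             ≡⟨ floorSum-extend N (k≤cutoff k x) ⟨
      sumBelow N (λ i → k /b^ suc i)         ≤⟨ sumBelow-mono N (λ i _ → hits-lower balanced (suc i) x) ⟩
      sumBelow N (λ i → hits (suc i) k x)    ≡⟨ partialOrd-as-hits k x N ≡n (≤-cutoff k x) ⟨
      n                                      ∎)
      where
      open ≤-Reasoning
      N = cutoff k x

    -- The point w reaches the lower bound ⌊k/b^m⌋ at every level at once, so a minimiser of the
    -- sum over all levels must reach it at every level too.
    minimum-attains-minima : ∀ {k x₀} → Balanced k → (∀ x → partialOrd b a k x₀ ≤∞ partialOrd b a k x) →
                             AttainsMinima k x₀
    minimum-attains-minima {k} {x₀} balanced x₀-min with attaining-point balanced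
    ... | w , w-min
      with partialOrd b a k x₀ in ≡n | subst (partialOrd b a k x₀ ≤∞_) (partialOrd-attaining k w w-min) (x₀-min w)
    ...   | fin n | fin≤fin n≤floorSum = attains
      where
      K = cutoff k x₀
      N = suc K
      levelwise : ∀ i → i < N → k /b^ suc i ≡ hits (suc i) k x₀
      levelwise = sumBelow-mono-tight N (λ i _ → hits-lower balanced (suc i) x₀) (begin
        sumBelow N (λ i → hits (suc i) k x₀)   ≡⟨ partialOrd-as-hits k x₀ N ≡n bounded ⟨
        n                                      ≤⟨ n≤floorSum ⟩
        floorSum k                             ≡⟨ floorSum-extend N (m≤n⇒m≤1+n (k≤cutoff k x₀)) ⟨
        sumBelow N (λ i → k /b^ suc i)         ∎)
        where
        open ≤-Reasoning
        bounded : ∀ j → j < k → ∣ x₀ - a j ∣ ≤ N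
        bounded j j<k = m≤n⇒m≤1+n (≤-cutoff k x₀ j j<k)
      attains : AttainsMinima k x₀
      attains zero = trans (hits-zero k x₀) (sym (n/1≡n k))
      attains (suc i) with i <? N
      ... | yes i<N = sym (levelwise i i<N)
      ... | no  i≮N = trans (n≤0⇒n≡0 (begin
        hits (suc i) k x₀   ≤⟨ hits-antitone k x₀ (m≤n⇒m≤1+n (≮⇒≥ i≮N)) ⟩
        hits N k x₀         ≡⟨ levelwise K ≤-refl ⟨
        k /b^ N             ≡⟨ /b^-vanishes k k≤N ⟩
        0                   ∎)) (sym (/b^-vanishes k (m≤n⇒m≤1+n (≤-trans k≤N (≮⇒≥ i≮N)))))
        where
        open ≤-Reasoning
        k≤N : k ≤ N
        k≤N = m≤n⇒m≤1+n (k≤cutoff k x₀)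

    always-balanced : (∀ k → Balanced k → AttainsMinima k (a k)) → ∀ k → Balanced k
    always-balanced attains zero    _ _ _ = z≤n
    always-balanced attains (suc k)       =
      balanced-suc (always-balanced attains k) (attains k (always-balanced attains k))

    b-ordering-alpha : IsBOrdering Allℤ b a → ∀ k → alphaOf b a k ≡ fin (floorSum k)
    b-ordering-alpha (_ , minimal) k = partialOrd-attaining k (a k) (attains k (always-balanced attains k))
      where
      attains : ∀ k → Balanced k → AttainsMinima k (a k)
      attains zero    balanced = minimum-attains-minima {0} {a 0} balanced λ _ → fin≤fin z≤n
      attains (suc i) balanced = minimum-attains-minima balanced λ x → minimal i x _

  naturals-attain : ∀ k → Hits.AttainsMinima naturals k (+ k)
  naturals-attain k m = begin
    sumBelow k (λ j → divides (b ^ m) (+ k - + j))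
      ≡⟨ sumBelow-cong k (λ j j<k → cong (divides (b ^ m)) (+k-+j≡+[k∸j] (<⇒≤ j<k))) ⟩
    sumBelow k (λ j → divides (b ^ m) (+ (k ∸ j)))
      ≡⟨ sumBelow-reverse k (λ n → divides (b ^ m) (+ n)) ⟩
    sumBelow k (λ j → divides (b ^ m) (+ suc j))
      ≡⟨ multiples-count (b ^ m) {{b^≢0 m}} k ⟩
    k /b^ m ∎
    where open ≡-Reasoning

  naturals-b-ordering : IsBOrdering Allℤ b naturals
  naturals-b-ordering = (λ _ → _) , λ i x _ →
    subst (_≤∞ partialOrd b naturals (suc i) x) (sym (partialOrd-attaining (suc i) (+ suc i) (naturals-attain (suc i))))
          (partialOrd-lower (always-balanced (λ k _ → naturals-attain k) (suc i)) x)
    where open Hits naturals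

fin0≤∞ : ∀ v → fin 0 ≤∞ v
fin0≤∞ (fin _) = fin≤fin z≤n
fin0≤∞ ∞       = _ ≤∞∞

ord-0 : ∀ y → ∣ y ∣ ≢ 0 → ord 0 y ≡ fin 0
ord-0 y y≢0 with ∣ y ∣
... | zero  = ⊥-elim (y≢0 refl)
... | suc _ = refl

partialOrd-0 : ∀ a k x → (∀ j → j < k → ∣ x - a j ∣ ≢ 0) → partialOrd 0 a k x ≡ fin 0
partialOrd-0 a zero    x distinct = refl
partialOrd-0 a (suc k) x distinct
  rewrite partialOrd-0 a k x (λ j j<k → distinct j (m<n⇒m<1+n j<k)) | ord-0 (x - a k) (distinct k ≤-refl) = refl

partialOrd-1 : ∀ a k x → partialOrd 1 a (suc k) x ≡ ∞
partialOrd-1 a k x with partialOrd 1 a k x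
... | fin _ = refl
... | ∞     = refl

-- For b = 0 the point 1 + Σ|aⱼ| differs from every earlier term, so its sum of orders is already 0.
0-ordering-alpha : ∀ a → IsBOrdering Allℤ 0 a → ∀ k → alphaOf 0 a k ≡ fin 0
0-ordering-alpha a _             zero    = refl
0-ordering-alpha a (_ , minimal) (suc i) =
  ≤∞fin0 (subst (partialOrd 0 a (suc i) (a (suc i)) ≤∞_) (partialOrd-0 a (suc i) far far-distinct) (minimal i far _))
  where
  S = sumBelow (suc i) (λ j → ∣ a j ∣)
  far = + suc S
  far-distinct : ∀ j → j < suc i → ∣ far - a j ∣ ≢ 0
  far-distinct j j<1+i ∣far-aⱼ∣≡0 =
    1+n≰n (subst (_≤ S) (cong ∣_∣ far≡aⱼ) (≤-sumBelow (suc i) (λ j → ∣ a j ∣) j<1+i))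
    where
    far≡aⱼ : a j ≡ far
    far≡aⱼ = sym (ℤₚ.i-j≡0⇒i≡j far (a j) (ℤₚ.∣i∣≡0⇒i≡0 ∣far-aⱼ∣≡0))
  ≤∞fin0 : ∀ {v} → v ≤∞ fin 0 → v ≡ fin 0
  ≤∞fin0 (fin≤fin z≤n) = refl

naturals-ordering : ∀ b → IsBOrdering Allℤ b naturals
naturals-ordering zero = (λ _ → _) , λ i x _ →
  subst (_≤∞ partialOrd 0 naturals (suc i) x) (sym (partialOrd-0 naturals (suc i) (+ suc i) (+k-+j≢0 (suc i))))
        (fin0≤∞ (partialOrd 0 naturals (suc i) x))
naturals-ordering (suc zero) = (λ _ → _) , λ i x _ →
  subst₂ _≤∞_ (sym (partialOrd-1 naturals i (+ suc i))) (sym (partialOrd-1 naturals i x)) (∞ ≤∞∞)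
naturals-ordering (suc (suc c)) = Radix.naturals-b-ordering c

floorDiv-nonZero : ∀ k d .{{_ : NonZero d}} → floorDiv k d ≡ k / d
floorDiv-nonZero k (suc d) = refl

pow∞-1 : ∀ v → pow∞ 1 v ≡ 1
pow∞-1 (fin n) = ^-zeroˡ n
pow∞-1 ∞       = refl

naturals-alpha : ∀ b k → IsAlpha Allℤ b k (alphaOf b naturals k)
naturals-alpha b k = naturals , naturals-ordering b , refl

alpha-floorSum : ∀ b k → 2 ≤ b →
  Σ ℕ∞ (IsAlpha Allℤ b k) ×
  ((v : ℕ∞) → IsAlpha Allℤ b k v → Σ ℕ λ n → (v ≡ fin n) × IsInfSum₁ (λ i → floorDiv k (b ^ i)) n)
alpha-floorSum (suc zero)    k (s≤s ())
alpha-floorSum (suc (suc c)) k _ = (_ , naturals-alpha b k) , λ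
  { v (a , a-ordering , refl) → floorSum k , Hits.b-ordering-alpha a a-ordering k , k , λ M k≤M →
      trans (sumBelow-cong M λ i _ → floorDiv-nonZero k (b ^ suc i) {{b^≢0 (suc i)}}) (floorSum-extend M k≤M) }
  where open Radix c

pow∞-alpha≡1 : ∀ b k {v} → IsAlpha Allℤ b k v → b ≤ 1 ⊎ k < b → pow∞ b v ≡ 1
pow∞-alpha≡1 zero          k (a , a-ordering , refl) _ = cong (pow∞ 0) (0-ordering-alpha a a-ordering k)
pow∞-alpha≡1 (suc zero)    k {v} _ _ = pow∞-1 v
pow∞-alpha≡1 (suc (suc c)) k _ (inj₁ (s≤s ()))
pow∞-alpha≡1 (suc (suc c)) k (a , a-ordering , refl) (inj₂ k<b) =
  cong (pow∞ b) (trans (Hits.b-ordering-alpha a a-ordering k) (cong fin (sumBelow-zero k λ i _ →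
    m<n⇒m/n≡0 {{b^≢0 (suc i)}} (<-≤-trans k<b (m≤m*n b (b ^ i) {{b^≢0 i}})))))
  where open Radix c

factorial-product : ∀ k (v : ℕ → ℕ∞) → (∀ b → IsAlpha Allℤ b k (v b)) →
                    IsInfProd (λ b → pow∞ b (v b)) (prodRange 2 k (λ b → pow∞ b (v b)))
factorial-product k v alpha = suc (suc k) , λ
  { (suc (suc M)) (s≤s (s≤s k≤M)) → begin
    prodBelow (suc (suc M)) f                    ≡⟨ prodBelow-suc (suc M) f ⟩
    f 0 * prodBelow (suc M) (λ b → f (suc b))    ≡⟨ cong (f 0 *_) (prodBelow-suc M (λ b → f (suc b))) ⟩
    f 0 * (f 1 * prodBelow M g)                  ≡⟨ cong₂ (λ u v → u * (v * prodBelow M g)) (trivial 0 (inj₁ z≤n))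
                                                                                             (trivial 1 (inj₁ ≤-refl)) ⟩
    1 * (1 * prodBelow M g)                      ≡⟨ trans (*-identityˡ _) (*-identityˡ _) ⟩
    prodBelow M g                                ≡⟨ prodBelow-eventually-one M (≤-trans (m∸n≤m k 1) k≤M) large ⟩
    prodBelow (suc k ∸ 2) g                      ∎ }
  where
  open ≡-Reasoning
  f : ℕ → ℕ
  f b = pow∞ b (v b)
  g : ℕ → ℕ
  g i = f (suc (suc i))
  trivial : ∀ b → b ≤ 1 ⊎ k < b → f b ≡ 1
  trivial b = pow∞-alpha≡1 b k (alpha b)
  large : ∀ i → suc k ∸ 2 ≤ i → g i ≡ 1
  large i k∸1≤i = trivial (suc (suc i)) (inj₂ (≤-trans (m≤n+m∸n (suc k) 2) (+-monoʳ-≤ 2 k∸1≤i)))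

theorem7p2 : ((b k : ℕ) → 2 ≤ b →
       Σ ℕ∞ (IsAlpha Allℤ b k) ×
       ((v : ℕ∞) → IsAlpha Allℤ b k v →
          Σ ℕ λ n → (v ≡ fin n) × IsInfSum₁ (λ i → floorDiv k (b ^ i)) n))
    ×
    ((k : ℕ) →
       Σ (ℕ → ℕ∞) (λ v → (b : ℕ) → IsAlpha Allℤ b k (v b)) ×
       ((v : ℕ → ℕ∞) → ((b : ℕ) → IsAlpha Allℤ b k (v b)) →
          IsInfProd (λ b → pow∞ b (v b)) (prodRange 2 k (λ b → pow∞ b (v b)))))
theorem7p2 = alpha-floorSum , λ k → ((λ b → alphaOf b naturals k) , λ b → naturals-alpha b k) , factorial-product k
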